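{- Let $(x,\Pi)$ and $(x',\Pi')$ be chopped reals. Then $\mathrm{Match}(x,\Pi)\subseteq\mathrm{Match}(x',\Pi')$ if and only if $(x,\Pi)$ engulfs $(x',\Pi')$.
   Context: A chopped real is a pair $(x,\Pi)$ where $x\in{}^\omega 2$ and $\Pi$ is a partition of $\omega$ into finite intervals $I_0=[a_0,a_1), I_1=[a_1,a_2),\dots$ with $0=a_0<a_1<a_2<\cdots$. A real $y\in{}^\omega2$ matches $(x,\Pi)$ if there are infinitely many $n$ with $y\restriction I_n=x\restriction I_n$; $\mathrm{Match}(x,\Pi)$ is the set of all $y\in{}^\omega2$ matching $(x,\Pi)$. A chopped real $(x,\Pi)$ engulfs $(x',\Pi')$ if all but finitely many intervals of $\Pi$ include some interval $J$ of $\Pi'$ such that $x\restriction J=x'\restriction J$. -}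

module Defs where

open import Data.Nat using (ℕ; zero; suc; _≤_; _<_)
open import Data.Bool using (Bool)
open import Data.Product using (Σ; ∃; _×_; _,_)
open import Relation.Binary.PropositionalEquality using (_≡_)
open import Relation.Unary using (Pred)
open import Level using (0ℓ)

Real : Set
Real = ℕ → Bool

-- A partition of ω into finite intervals I_n = [a n, a (suc n)),
-- given by its endpoints with a 0 = 0 and a strictly increasing.
record Partition : Set where
  constructor partition
  field
    a       : ℕ → ℕ
    a-zero  : a zero ≡ zero
    a-incr  : ∀ n → a n < a (suc n)
open Partition public

record Chopped : Set where
  constructor chopped
  field
    real : Real
    part : Partition
open Chopped public

_∈I[_]_ : ℕ → Partition → ℕ → Set
i ∈I[ Π ] n = a Π n ≤ i × i < a Π (suc n)

AgreeOn : Real → Real → Partition → ℕ → Set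
AgreeOn y x Π n = ∀ i → i ∈I[ Π ] n → y i ≡ x i

Matches : Chopped → Real → Set
Matches (chopped x Π) y = ∀ m → ∃ λ n → m ≤ n × AgreeOn y x Π n

Match : Chopped → Pred Real 0ℓ
Match c = Matches c

Engulfs : Chopped → Chopped → Set
Engulfs (chopped x Π) (chopped x' Π') =
  ∃ λ N → ∀ n → N ≤ n →
    ∃ λ k → a Π n ≤ a Π' k × a Π' (suc k) ≤ a Π (suc n) × AgreeOn x x' Π' k

-- If (x, Π) fails to engulf (x', Π'), there are infinitely many intervals I_n of Π containing
-- no interval of Π' on which x and x' agree; thin them out greedily so that no two chosen
-- intervals are adjacent.  Let y copy x on the chosen intervals and disagree with x' everywhere
-- else.  Then y matches (x, Π), but y agrees with x' on no interval J of Π': if min J lies in a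
-- chosen I_n, then J ⊆ I_n is excluded by the choice of n, while otherwise J contains
-- min I_(n+1), which lies in an unchosen interval.
module Submission where

open import Defs
open import Level using (0ℓ)
open import Relation.Unary using (Pred; _⊆_; _∈_; _∉_)
open import Function.Base using (_∘_)
open import Function.Bundles using (_⇔_; mk⇔)
open import Axiom.ExcludedMiddle using (ExcludedMiddle)
open import Axiom.DoubleNegationElimination using (em⇒dne)
open import Data.Nat using (ℕ; zero; suc; _≤_; _<_; _⊔_; z≤n; s≤s; s≤s⁻¹; _≤?_)
open import Data.Nat.Properties
open import Data.Bool using (not; if_then_else_)
open import Data.Bool.Properties using (not-¬)
open import Data.Product using (∃; _×_; _,_)
open import Data.Sum using (inj₁; inj₂)
open import Relation.Nullary using (¬_; yes; no; does; contradiction)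
open import Relation.Binary.Definitions using (tri<; tri≈; tri>)
open import Relation.Nullary.Decidable using (dec-true; dec-false)
open import Relation.Binary.PropositionalEquality using (_≡_; refl; sym; trans; subst)

InfinitelyOften : Pred ℕ 0ℓ → Set
InfinitelyOften P = ∀ m → ∃ λ n → m ≤ n × P n

Eventually : Pred ℕ 0ℓ → Set
Eventually P = ∃ λ N → ∀ n → N ≤ n → P n

¬Eventually⇒InfinitelyOften¬ : ExcludedMiddle 0ℓ → {P : Pred ℕ 0ℓ} →
                               ¬ Eventually P → InfinitelyOften (¬_ ∘ P)
¬Eventually⇒InfinitelyOften¬ em ¬ev m =
  em⇒dne em λ ¬io → ¬ev (m , λ n m≤n → em⇒dne em λ ¬p → ¬io (n , m≤n , ¬p))

Thin : Pred ℕ 0ℓ → Pred ℕ 0ℓ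
Thin P zero    = P zero
Thin P (suc n) = ¬ Thin P n × P (suc n)

Thin⊆ : {P : Pred ℕ 0ℓ} → Thin P ⊆ P
Thin⊆ {x = zero}  p       = p
Thin⊆ {x = suc n} (_ , p) = p

Thin⇒¬Thin-suc : {P : Pred ℕ 0ℓ} → ∀ n → Thin P n → ¬ Thin P (suc n)
Thin⇒¬Thin-suc n t (¬t , _) = ¬t t

Thin-infinitelyOften : ExcludedMiddle 0ℓ → {P : Pred ℕ 0ℓ} →
                       InfinitelyOften P → InfinitelyOften (Thin P)
Thin-infinitelyOften em io m with io (suc m)
... | suc n , s≤s m≤n , p with em {Thin _ n}
...   | yes t = n , m≤n , t
...   | no ¬t = suc n , m≤n⇒m≤1+n m≤n , ¬t , p

module StrictlyIncreasing {f : ℕ → ℕ} (f-incr : ∀ n → f n < f (suc n)) where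

  f-mono-< : ∀ {m n} → m < n → f m < f n
  f-mono-< {m} {suc n} m<1+n with m≤n⇒m<n∨m≡n (s≤s⁻¹ m<1+n)
  ... | inj₁ m<n  = <-trans (f-mono-< m<n) (f-incr n)
  ... | inj₂ refl = f-incr m

  f-mono-≤ : ∀ {m n} → m ≤ n → f m ≤ f n
  f-mono-≤ m≤n with m≤n⇒m<n∨m≡n m≤n
  ... | inj₁ m<n  = <⇒≤ (f-mono-< m<n)
  ... | inj₂ refl = ≤-refl

  f-cancel-≤ : ∀ {m n} → f m ≤ f n → m ≤ n
  f-cancel-≤ fm≤fn = ≮⇒≥ λ n<m → <⇒≱ (f-mono-< n<m) fm≤fn

  n≤f : ∀ n → n ≤ f n
  n≤f zero    = z≤n
  n≤f (suc n) = ≤-trans (s≤s (n≤f n)) (f-incr n)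

module _ (Π : Partition) where
  open StrictlyIncreasing (a-incr Π)

  a-cancel-≤ : ∀ {m n} → a Π m ≤ a Π n → m ≤ n
  a-cancel-≤ = f-cancel-≤

  n≤a : ∀ n → n ≤ a Π n
  n≤a = n≤f

  a∈I : ∀ n → a Π n ∈I[ Π ] n
  a∈I n = ≤-refl , a-incr Π n

  ∈I-unique : ∀ {i m n} → i ∈I[ Π ] m → i ∈I[ Π ] n → m ≡ n
  ∈I-unique {i} {m} {n} (am≤i , i<am+1) (an≤i , i<an+1) with <-cmp m n
  ... | tri≈ _ m≡n _ = m≡n
  ... | tri< m<n _ _ = contradiction (≤-trans (f-mono-≤ m<n) an≤i) (<⇒≱ i<am+1)
  ... | tri> _ _ n<m = contradiction (≤-trans (f-mono-≤ n<m) am≤i) (<⇒≱ i<an+1)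

Captures : Chopped → Chopped → Pred ℕ 0ℓ
Captures (chopped x Π) (chopped x' Π') n =
  ∃ λ k → a Π n ≤ a Π' k × a Π' (suc k) ≤ a Π (suc n) × AgreeOn x x' Π' k

Engulfs⇒Match⊆ : (c c' : Chopped) → Engulfs c c' → Match c ⊆ Match c'
Engulfs⇒Match⊆ (chopped x Π) (chopped x' Π') (N , engulf) {y} y-matches m
  with y-matches (N ⊔ a Π' m)
... | n , N⊔a'm≤n , y≈x with engulf n (m⊔n≤o⇒m≤o N _ N⊔a'm≤n)
...   | k , an≤a'k , a'k+1≤an+1 , x≈x' =
  k , m≤k , λ i i∈J → trans (y≈x i (J⊆I i∈J)) (x≈x' i i∈J)
  where
  J⊆I : ∀ {i} → i ∈I[ Π' ] k → i ∈I[ Π ] n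
  J⊆I (a'k≤i , i<a'k+1) = ≤-trans an≤a'k a'k≤i , <-≤-trans i<a'k+1 a'k+1≤an+1

  m≤k : m ≤ k
  m≤k = a-cancel-≤ Π' (≤-trans (m⊔n≤o⇒n≤o N _ N⊔a'm≤n) (≤-trans (n≤a Π n) an≤a'k))

module Separating (em : ExcludedMiddle 0ℓ) (x x' : Real) (Π Π' : Partition)
  (S : Pred ℕ 0ℓ)
  (S-spaced : ∀ n → S n → ¬ S (suc n))
  (S-infinite : InfinitelyOften S)
  (S-uncaptured : ∀ n → S n → ¬ Captures (chopped x Π) (chopped x' Π') n)
  where

  InS : Pred ℕ 0ℓ
  InS i = ∃ λ n → S n × i ∈I[ Π ] n

  y : Real
  y i = if does (em {InS i}) then x i else not (x' i)

  y≡x : ∀ {n i} → S n → i ∈I[ Π ] n → y i ≡ x i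
  y≡x {n} {i} s i∈I rewrite dec-true (em {InS i}) (n , s , i∈I) = refl

  y≡not-x' : ∀ {i} → ¬ InS i → y i ≡ not (x' i)
  y≡not-x' {i} ¬inS rewrite dec-false (em {InS i}) ¬inS = refl

  a-suc∉S : ∀ {n} → S n → ¬ InS (a Π (suc n))
  a-suc∉S {n} s (m , sm , a[n+1]∈Im) =
    S-spaced n s (subst S (∈I-unique Π a[n+1]∈Im (a∈I Π (suc n))) sm)

  y-matches : y ∈ Match (chopped x Π)
  y-matches m with S-infinite m
  ... | n , m≤n , s = n , m≤n , λ i → y≡x s

  y-disagrees : ∀ k → ¬ AgreeOn y x' Π' k
  y-disagrees k y≈x' with em {InS (a Π' k)}
  ... | no ¬inS = not-¬ (y≈x' (a Π' k) (a∈I Π' k)) (y≡not-x' ¬inS)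
  ... | yes (n , s , an≤a'k , a'k<an+1) with a Π' (suc k) ≤? a Π (suc n)
  ...   | yes a'k+1≤an+1 = S-uncaptured n s (k , an≤a'k , a'k+1≤an+1 , x≈x')
    where
    x≈x' : AgreeOn x x' Π' k
    x≈x' i (a'k≤i , i<a'k+1) =
      trans (sym (y≡x s (≤-trans an≤a'k a'k≤i , <-≤-trans i<a'k+1 a'k+1≤an+1)))
            (y≈x' i (a'k≤i , i<a'k+1))
  ...   | no a'k+1≰an+1 =
    not-¬ (y≈x' (a Π (suc n)) (<⇒≤ a'k<an+1 , ≰⇒> a'k+1≰an+1)) (y≡not-x' (a-suc∉S s))

  y∉Match : y ∉ Match (chopped x' Π')
  y∉Match y-matches' with y-matches' 0
  ... | k , _ , y≈x' = y-disagrees k y≈x'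

¬Engulfs⇒separated : ExcludedMiddle 0ℓ → (c c' : Chopped) → ¬ Engulfs c c' →
                     ∃ λ y → y ∈ Match c × y ∉ Match c'
¬Engulfs⇒separated em c@(chopped x Π) c'@(chopped x' Π') ¬engulf =
  y , y-matches , y∉Match
  where
  Uncaptured : Pred ℕ 0ℓ
  Uncaptured = ¬_ ∘ Captures c c'

  open Separating em x x' Π Π' (Thin Uncaptured) Thin⇒¬Thin-suc
    (Thin-infinitelyOften em (¬Eventually⇒InfinitelyOften¬ em ¬engulf)) (λ _ → Thin⊆ {Uncaptured})

mainTheorem2 : ExcludedMiddle 0ℓ → (c c' : Chopped) → (Match c ⊆ Match c') ⇔ Engulfs c c'
mainTheorem2 em c c' = mk⇔ Match⊆⇒Engulfs (Engulfs⇒Match⊆ c c')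
  where
  Match⊆⇒Engulfs : Match c ⊆ Match c' → Engulfs c c'
  Match⊆⇒Engulfs match⊆ = em⇒dne em λ ¬engulf →
    let (y , y∈Match , y∉Match') = ¬Engulfs⇒separated em c c' ¬engulf
    in  y∉Match' (match⊆ y∈Match)
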